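{- Let $q\ge 2$ and $n\ge1$ be integers, and let $D=\{d_1,\ldots,d_k\}\subseteq\{1,\ldots,n\}$ with $1\le d_1<\cdots<d_k\le n$. Consider the distance graph $G(\mathbb{Z}_q^n,D)$ of $(\mathbb{Z}_q^n,\rho)$, $\rho$ the RT metric. Then: (1) $G(\mathbb{Z}_q^n,D)$ is regular of degree $(q-1)\sum_{i=1}^k q^{d_i-1}$. (2) $G(\mathbb{Z}_q^n,D)$ is connected if and only if $n\in D$. (3) For any integer $m\ge1$ and any nonempty $D_1\subseteq\{1,\ldots,m\}$, the components of $G(\mathbb{Z}_q^n,D)$ are isomorphic to the components of $G(\mathbb{Z}_q^m,D_1)$ if and only if $D=D_1$. (4) The chromatic number satisfies $\chi(G(\mathbb{Z}_q^n,D))=q^k$. (5) For any two nonempty distance sets $D_1,D_2\subseteq\{1,\ldots,n\}$, $\chi(G(\mathbb{Z}_q^n,D_1))=\chi(G(\mathbb{Z}_q^n,D_2))$ if and only if $|D_1|=|D_2|$.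
   Context: $\mathbb{Z}_q=\{0,1,\ldots,q-1\}$ (integers mod $q$). For $x=(x_1,\ldots,x_n)\in\mathbb{Z}_q^n$, the RT weight is $\omega(x)=\max\{i: x_i\neq 0\}$ if $x\ne 0$ and $\omega(0)=0$; the RT (Rosenbloom–Tsfasman) distance is $\rho(x,y)=\omega(x-y)$. For a metric space $(X,d)$ and a set $D$ of positive reals, the distance graph $G(X,D)$ has vertex set $X$ and an edge $xy$ for distinct $x,y\in X$ whenever $d(x,y)\in D$. $\chi$ denotes chromatic number. -}

module Defs where

open import Data.Nat using (ℕ; zero; suc; _+_; _∸_; _^_; _*_; _≤_)
open import Data.Nat.DivMod using (_mod_)
open import Data.Bool using (if_then_else_)
open import Data.Fin using (Fin; toℕ; zero; suc)
open import Data.Fin.Subset using (Subset; _∈_)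
open import Data.Fin.Subset.Properties using (_∈?_)
open import Data.Vec using (Vec; []; _∷_; zipWith; tabulate; sum)
open import Data.List using (List; length)
open import Data.List.Relation.Unary.Unique.Propositional using (Unique)
import Data.List.Membership.Propositional as LM
open import Data.Product using (Σ; _×_)
open import Relation.Binary.PropositionalEquality using (_≡_; _≢_)
open import Relation.Nullary.Decidable using (⌊_⌋)
open import Relation.Binary.Construct.Closure.ReflexiveTransitive using (Star)
open import Function.Bundles using (_⇔_)

subZ : {q : ℕ} → Fin q → Fin q → Fin q
subZ {suc k} a b = (toℕ a + (suc k ∸ toℕ b)) mod (suc k)

-- RT weight: largest 1-based index i with x_i ≠ 0 (0 for the zero vector).
-- The head of the vector is coordinate 1.
private
  step : {q : ℕ} → Fin q → ℕ → ℕ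
  step zero    zero    = 0
  step (suc _) zero    = 1
  step _       (suc j) = suc (suc j)

ω : {q n : ℕ} → Vec (Fin q) n → ℕ
ω []       = 0
ω (a ∷ xs) = step a (ω xs)

ρ : {q n : ℕ} → Vec (Fin q) n → Vec (Fin q) n → ℕ
ρ x y = ω (zipWith subZ x y)

-- A subset D ⊆ {1,…,n} is encoded as a Subset n; position i (0-based) ↦ distance i+1.
_∈ℕ_ : {n : ℕ} → ℕ → Subset n → Set
_∈ℕ_ {n} d D = Σ (Fin n) (λ i → (suc (toℕ i) ≡ d) × (i ∈ D))

SameSet : {n m : ℕ} → Subset n → Subset m → Set
SameSet D D₁ = ∀ d → (d ∈ℕ D) ⇔ (d ∈ℕ D₁)

rtSum : {n : ℕ} → ℕ → Subset n → ℕ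
rtSum q D = sum (tabulate (λ i → if ⌊ i ∈? D ⌋ then q ^ toℕ i else 0))

record Graph : Set₁ where
  field
    V   : Set
    Adj : V → V → Set
open Graph public

DistGraph : (q n : ℕ) → Subset n → Graph
DistGraph q n D = record
  { V   = Vec (Fin q) n
  ; Adj = λ x y → (x ≢ y) × (ρ x y ∈ℕ D) }

Degree : (G : Graph) → V G → ℕ → Set
Degree G x d = Σ (List (V G)) (λ ys →
  Unique ys × (∀ y → (y LM.∈ ys) ⇔ Adj G x y) × (length ys ≡ d))

Regular : Graph → ℕ → Set
Regular G d = ∀ x → Degree G x d

Reach : (G : Graph) → V G → V G → Set
Reach G = Star (Adj G)

Connected : Graph → Set
Connected G = ∀ x y → Reach G x y

CompIso : (G H : Graph) → V G → V H → Set
CompIso G H x y = Σ (V G → V H) (λ f → Σ (V H → V G) (λ g →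
    (∀ u → Reach G x u → Reach H y (f u))
  × (∀ w → Reach H y w → Reach G x (g w))
  × (∀ u → Reach G x u → g (f u) ≡ u)
  × (∀ w → Reach H y w → f (g w) ≡ w)
  × (∀ u v → Reach G x u → Reach G x v → Adj G u v ⇔ Adj H (f u) (f v))))

ComponentsIso : Graph → Graph → Set
ComponentsIso G H = ∀ x y → CompIso G H x y

Colorable : Graph → ℕ → Set
Colorable G c = Σ (V G → Fin c) (λ f → ∀ x y → Adj G x y → f x ≢ f y)

ChromaticNumber : Graph → ℕ → Set
ChromaticNumber G c = Colorable G c × (∀ c' → Colorable G c' → c ≤ c')

-- The RT distance is an ultrametric, so a path in G(ℤ_q^n, D) never leaves the ρ-ball of
-- radius K = max D around its start; conversely (q ≥ 2) two points of that ball are joined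
-- through a point at distance exactly K from both. The components are therefore exactly these
-- balls: G is connected iff K = n, and overwriting the first K coordinates maps a component of
-- G(ℤ_q^n, D) isomorphically onto one of G(ℤ_q^m, D). Listing the neighbours of a vertex
-- coordinate by coordinate gives the degree (q − 1) Σ_{d ∈ D} q^(d−1), a base-q numeral from
-- which D can be read off, so isomorphic components force equal distance sets. Finally the
-- projection onto the coordinates in D is a proper colouring with q^|D| colours, and the
-- vectors vanishing outside D form a clique of the same size.

module Submission where

open import Data.Bool using (Bool; true; false; if_then_else_)
open import Data.Empty using (⊥-elim)
open import Data.Fin as Fin using (Fin; toℕ; zero; suc)
import Data.Fin.Properties as Fin
open import Data.Fin.Subset as Subset using (Subset; Nonempty; ∣_∣)
open import Data.Fin.Subset.Properties using (nonempty?; _∈?_)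
open import Data.List as List using (List; []; _++_; length; cartesianProductWith; allFin)
import Data.List.Properties as List
open import Data.List.Membership.Propositional using (_∈_)
open import Data.List.Membership.Propositional.Properties
  using (∈-map⁺; ∈-map⁻; ++-∈⇔; ∈-allFin; ∈-cartesianProductWith⁺; ∈-cartesianProductWith⁻)
open import Data.List.Membership.Propositional.Properties.WithK using (unique∧set⇒bag)
open import Data.List.Relation.Binary.BagAndSetEquality using (∼bag⇒↭)
open import Data.List.Relation.Binary.Disjoint.Propositional using (Disjoint)
open import Data.List.Relation.Binary.Permutation.Propositional.Properties using (↭-length)
import Data.List.Relation.Unary.All as All
open import Data.List.Relation.Unary.AllPairs using ([])
open import Data.List.Relation.Unary.Unique.Propositional using (Unique)
import Data.List.Relation.Unary.Unique.Propositional.Properties as Unique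
open import Data.Nat
open import Data.Nat.DivMod
open import Data.Nat.Divisibility using (m%n≡0⇒n∣m)
open import Data.Nat.Properties
open import Algebra.Properties.CommutativeSemigroup *-commutativeSemigroup using (x∙yz≈y∙xz)
open import Data.Product
open import Data.Sum using (_⊎_; inj₁; inj₂)
open import Data.Sum.Function.Propositional using (_⊎-⇔_)
open import Data.Vec using (Vec; []; _∷_; here; there; sum; tabulate; replicate)
open import Data.Vec.Properties using (∷-injective; ∷-injectiveˡ)
open import Function.Base using (_∘_; id)
open import Function.Bundles using (_⇔_; mk⇔; module Equivalence)
open import Function.Properties.Equivalence using () renaming (trans to ⇔-trans; sym to ⇔-sym)
open import Relation.Binary.Construct.Closure.ReflexiveTransitive using (ε; _◅_; _◅◅_)
open import Relation.Binary.Definitions using (tri<; tri≈; tri>)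
open import Relation.Binary.PropositionalEquality
open import Relation.Nullary
open import Relation.Nullary.Decidable using (decidable-stable; ⌊_⌋)

open import Defs

open Equivalence using (to; from)

private
  variable
    k n m r d d′ K : ℕ
    s : Bool
    c c′ : ℕ
    G H : Graph
    A B C : Set

toℕ-subZ : (a b : Fin (suc k)) → toℕ (subZ a b) ≡ (toℕ a + (suc k ∸ toℕ b)) % suc k
toℕ-subZ {k} a b = Fin.toℕ-fromℕ< (m%n<n (toℕ a + (suc k ∸ toℕ b)) (suc k))

subZ-self : (a : Fin (suc k)) → subZ a a ≡ zero
subZ-self {k} a = Fin.toℕ-injective (begin
  toℕ (subZ a a)                    ≡⟨ toℕ-subZ a a ⟩
  (toℕ a + (suc k ∸ toℕ a)) % suc k ≡⟨ cong (_% suc k) (m+[n∸m]≡n (Fin.toℕ≤n a)) ⟩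
  suc k % suc k                     ≡⟨ n%n≡0 (suc k) ⟩
  0                                 ∎)
  where open ≡-Reasoning

-- q divides t = a + (q ∸ b), so a ≡ a + q = t + b ≡ b modulo q.
subZ≡zero⇒≡ : (a b : Fin (suc k)) → subZ a b ≡ zero → a ≡ b
subZ≡zero⇒≡ {k} a b eq = Fin.toℕ-injective (begin
  toℕ a                      ≡⟨ m<n⇒m%n≡m (Fin.toℕ<n a) ⟨
  toℕ a % q                  ≡⟨ [m+n]%n≡m%n (toℕ a) q ⟨
  (toℕ a + q) % q            ≡⟨ cong (_% q) t+b≡a+q ⟨
  (t + toℕ b) % q            ≡⟨ %-remove-+ˡ (toℕ b) (m%n≡0⇒n∣m t q (trans (sym (toℕ-subZ a b)) (cong toℕ eq))) ⟩
  toℕ b % q                  ≡⟨ m<n⇒m%n≡m (Fin.toℕ<n b) ⟩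
  toℕ b                      ∎)
  where
    open ≡-Reasoning
    q = suc k
    t = toℕ a + (q ∸ toℕ b)
    t+b≡a+q : t + toℕ b ≡ toℕ a + q
    t+b≡a+q = trans (+-assoc (toℕ a) _ _) (cong (toℕ a +_) (m∸n+n≡m (Fin.toℕ≤n b)))

ρ-self : (x : Vec (Fin (suc k)) n) → ρ x x ≡ 0
ρ-self [] = refl
ρ-self (a ∷ x) rewrite subZ-self a | ρ-self x = refl

ρ-self-≤ : (x : Vec (Fin (suc k)) n) → ρ x x ≤ K
ρ-self-≤ x = subst (_≤ _) (sym (ρ-self x)) z≤n

ρ≡0⇒≡ : (x y : Vec (Fin (suc k)) n) → ρ x y ≡ 0 → x ≡ y
ρ≡0⇒≡ [] [] _ = refl
ρ≡0⇒≡ (a ∷ x) (b ∷ y) e with subZ a b in ab | ρ x y in xy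
... | zero  | zero  = cong₂ _∷_ (subZ≡zero⇒≡ a b ab) (ρ≡0⇒≡ x y xy)
... | zero  | suc _ = contradiction e λ ()
... | suc _ | suc _ = contradiction e λ ()

ρ-∷-head : {a b : Fin (suc k)} (x : Vec (Fin (suc k)) n) → a ≢ b → ρ (a ∷ x) (b ∷ x) ≡ 1
ρ-∷-head {a = a} {b} x a≢b rewrite ρ-self x with subZ a b in ab
... | zero  = ⊥-elim (a≢b (subZ≡zero⇒≡ a b ab))
... | suc _ = refl

ρ-∷-tail : (a b : Fin (suc k)) (x y : Vec (Fin (suc k)) n) → ρ x y ≡ suc r →
           ρ (a ∷ x) (b ∷ y) ≡ suc (suc r)
ρ-∷-tail a b x y e with subZ a b | ρ x y
... | zero  | suc _ = cong suc e
... | suc _ | suc _ = cong suc e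

ρ-∷-cong : (a b : Fin (suc k)) (x y : Vec (Fin (suc k)) n) (x′ y′ : Vec (Fin (suc k)) m) →
           ρ x y ≡ ρ x′ y′ → ρ (a ∷ x) (b ∷ y) ≡ ρ (a ∷ x′) (b ∷ y′)
ρ-∷-cong a b x y x′ y′ e rewrite e = refl

-- The head is the least significant coordinate: it only matters when the tails agree.
data ρ-∷-View (a b : Fin (suc k)) (x y : Vec (Fin (suc k)) n) : Set where
  heads-equal  : a ≡ b → x ≡ y → ρ-∷-View a b x y
  heads-differ : a ≢ b → x ≡ y → ρ-∷-View a b x y
  tails-differ : ∀ {r} → ρ x y ≡ suc r → ρ-∷-View a b x y

ρ-∷-view : (a b : Fin (suc k)) (x y : Vec (Fin (suc k)) n) → ρ-∷-View a b x y
ρ-∷-view a b x y with ρ x y in xy | a Fin.≟ b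
... | zero  | yes a≡b = heads-equal a≡b (ρ≡0⇒≡ x y xy)
... | zero  | no a≢b  = heads-differ a≢b (ρ≡0⇒≡ x y xy)
... | suc _ | _       = tails-differ xy

ρ-sym : (x y : Vec (Fin (suc k)) n) → ρ x y ≡ ρ y x
ρ-sym [] [] = refl
ρ-sym (a ∷ x) (b ∷ y) with ρ-∷-view a b x y
... | heads-equal refl refl = refl
... | heads-differ a≢b refl = trans (ρ-∷-head x a≢b) (sym (ρ-∷-head x (a≢b ∘ sym)))
... | tails-differ e        = trans (ρ-∷-tail a b x y e) (sym (ρ-∷-tail b a y x (trans (ρ-sym y x) e)))

ρ-∷-≤ : (a b : Fin (suc k)) (x y : Vec (Fin (suc k)) n) →
        ρ (a ∷ x) (b ∷ y) ≤ suc K ⇔ ρ x y ≤ K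
ρ-∷-≤ a b x y with ρ-∷-view a b x y
... | heads-equal refl refl = mk⇔ (λ _ → ρ-self-≤ x) (λ _ → ρ-self-≤ (a ∷ x))
... | heads-differ a≢b refl = mk⇔ (λ _ → ρ-self-≤ x)
                                  (λ _ → subst (_≤ _) (sym (ρ-∷-head x a≢b)) (s≤s z≤n))
... | tails-differ e = mk⇔ (λ p → subst (_≤ _) (sym e) (s≤s⁻¹ (subst (_≤ _) (ρ-∷-tail a b x y e) p)))
                           (λ p → subst (_≤ _) (sym (ρ-∷-tail a b x y e)) (s≤s (subst (_≤ _) e p)))

ρ-ultrametric : (K : ℕ) (x y z : Vec (Fin (suc k)) n) → ρ x y ≤ K → ρ y z ≤ K → ρ x z ≤ K
ρ-ultrametric zero x y z p q
  with refl ← ρ≡0⇒≡ x y (n≤0⇒n≡0 p) | refl ← ρ≡0⇒≡ y z (n≤0⇒n≡0 q) = p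
ρ-ultrametric (suc K) [] [] [] _ _ = z≤n
ρ-ultrametric (suc K) (a ∷ x) (b ∷ y) (c ∷ z) p q =
  from (ρ-∷-≤ a c x z) (ρ-ultrametric K x y z (to (ρ-∷-≤ a b x y) p) (to (ρ-∷-≤ b c y z) q))

ρ≤n : (x y : Vec (Fin (suc k)) n) → ρ x y ≤ n
ρ≤n [] [] = z≤n
ρ≤n (a ∷ x) (b ∷ y) = from (ρ-∷-≤ a b x y) (ρ≤n x y)

0∉ℕ : (D : Subset n) → ¬ 0 ∈ℕ D
0∉ℕ D (_ , () , _)

∈ℕ⇒≤ : {D : Subset n} → d ∈ℕ D → d ≤ n
∈ℕ⇒≤ (i , refl , _) = Fin.toℕ<n i

∈ℕ-there : {D : Subset n} → d ∈ℕ D → suc d ∈ℕ (s ∷ D)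
∈ℕ-there (i , refl , i∈D) = suc i , refl , there i∈D

∈ℕ-there⁻ : {D : Subset n} → suc (suc d) ∈ℕ (s ∷ D) → suc d ∈ℕ D
∈ℕ-there⁻ (suc i , refl , there i∈D) = i , refl , i∈D

1∈ℕ⇒head : {D : Subset n} → 1 ∈ℕ (s ∷ D) → s ≡ true
1∈ℕ⇒head (zero , refl , here) = refl

ρ-∷-∈ℕ : {D : Subset n} (a b : Fin (suc k)) (x y : Vec (Fin (suc k)) n) →
         ρ (a ∷ x) (b ∷ y) ∈ℕ (s ∷ D) ⇔ ((a ≢ b × x ≡ y × s ≡ true) ⊎ ρ x y ∈ℕ D)
ρ-∷-∈ℕ {D = D} a b x y with ρ-∷-view a b x y
... | heads-equal refl refl = mk⇔
  (λ p → ⊥-elim (0∉ℕ _ (subst (_∈ℕ _) (ρ-self (a ∷ x)) p)))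
  (λ { (inj₁ (a≢a , _)) → ⊥-elim (a≢a refl) ; (inj₂ p) → ⊥-elim (0∉ℕ D (subst (_∈ℕ D) (ρ-self x) p)) })
... | heads-differ a≢b refl = mk⇔
  (λ p → inj₁ (a≢b , refl , 1∈ℕ⇒head (subst (_∈ℕ _) (ρ-∷-head x a≢b) p)))
  (λ { (inj₁ (_ , _ , refl)) → subst (_∈ℕ _) (sym (ρ-∷-head x a≢b)) (zero , refl , here)
     ; (inj₂ p) → ⊥-elim (0∉ℕ D (subst (_∈ℕ D) (ρ-self x) p)) })
... | tails-differ e = mk⇔
  (λ p → inj₂ (subst (_∈ℕ D) (sym e) (∈ℕ-there⁻ (subst (_∈ℕ _) (ρ-∷-tail a b x y e) p))))
  (λ { (inj₁ (_ , refl , _)) → ⊥-elim (0≢1+n (trans (sym (ρ-self x)) e))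
     ; (inj₂ p) → subst (_∈ℕ _) (sym (ρ-∷-tail a b x y e)) (∈ℕ-there (subst (_∈ℕ D) e p)) })

IsMaximum : Subset n → ℕ → Set
IsMaximum D K = K ∈ℕ D × (∀ {d} → d ∈ℕ D → d ≤ K)

maximum : (D : Subset n) → Nonempty D → Σ ℕ (IsMaximum D)
maximum (s ∷ D) (i , i∈sD) with nonempty? D
... | yes D≠∅ = shift (maximum D D≠∅)
  where
    shift : Σ ℕ (IsMaximum D) → Σ ℕ (IsMaximum (s ∷ D))
    shift (K , K∈D , K-max) = suc K , ∈ℕ-there K∈D , λ where
      (zero  , refl , _)         → s≤s z≤n
      (suc j , refl , there j∈D) → s≤s (K-max (j , refl , j∈D))
... | no D=∅ = 1 , head∈ i i∈sD , 1-max
  where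
    head∈ : (i : Fin (suc _)) → i Subset.∈ (s ∷ D) → 1 ∈ℕ (s ∷ D)
    head∈ zero    p           = zero , refl , p
    head∈ (suc j) (there j∈D) = ⊥-elim (D=∅ (j , j∈D))
    1-max : d ∈ℕ (s ∷ D) → d ≤ 1
    1-max (zero  , refl , _)         = ≤-refl
    1-max (suc j , _    , there j∈D) = ⊥-elim (D=∅ (j , j∈D))

IsMaximum-SameSet : {D : Subset n} {D₁ : Subset m} → SameSet D D₁ → IsMaximum D K → IsMaximum D₁ K
IsMaximum-SameSet same (K∈D , K-max) = to (same _) K∈D , λ d∈D₁ → K-max (from (same _) d∈D₁)

SameSet-∷ : {D : Subset n} {D₁ : Subset m} → SameSet D D₁ → SameSet (s ∷ D) (s ∷ D₁)
SameSet-∷ {s = s} same d = mk⇔ (shift same) (shift (⇔-sym ∘ same))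
  where
    shift : ∀ {n m} {D : Subset n} {D₁ : Subset m} → SameSet D D₁ → d ∈ℕ (s ∷ D) → d ∈ℕ (s ∷ D₁)
    shift _    (zero  , refl , here)       = zero , refl , here
    shift same (suc i , refl , there i∈D) = ∈ℕ-there (to (same _) (i , refl , i∈D))

SameSet-∅ : {D : Subset n} {D₁ : Subset m} → (∀ {d} → ¬ d ∈ℕ D) → (∀ {d} → ¬ d ∈ℕ D₁) → SameSet D D₁
SameSet-∅ D=∅ D₁=∅ _ = mk⇔ (⊥-elim ∘ D=∅) (⊥-elim ∘ D₁=∅)

-- rtSum q D as a base-q numeral

bit : Bool → ℕ
bit true  = 1
bit false = 0

sum-tabulate-* : (c : ℕ) {f g : Fin n → ℕ} → (∀ i → f i ≡ c * g i) → sum (tabulate f) ≡ c * sum (tabulate g)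
sum-tabulate-* {zero}  c _  = sym (*-zeroʳ c)
sum-tabulate-* {suc n} c eq =
  trans (cong₂ _+_ (eq zero) (sum-tabulate-* c (eq ∘ suc))) (sym (*-distribˡ-+ c _ _))

rtSum-∷ : (q : ℕ) (s : Bool) (D : Subset n) → rtSum q (s ∷ D) ≡ bit s + q * rtSum q D
rtSum-∷ q s D = cong₂ _+_ (head s) (sum-tabulate-* q tail)
  where
    head : ∀ s → (if ⌊ zero ∈? (s ∷ D) ⌋ then q ^ 0 else 0) ≡ bit s
    head true  = refl
    head false = refl
    tail : ∀ i → (if ⌊ suc i ∈? (s ∷ D) ⌋ then q ^ toℕ (suc i) else 0) ≡ q * (if ⌊ i ∈? D ⌋ then q ^ toℕ i else 0)
    tail i with i ∈? D
    ... | yes _ = refl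
    ... | no  _ = sym (*-zeroʳ q)

bit-injective : {s t : Bool} → bit s ≡ bit t → s ≡ t
bit-injective {true}  {true}  _ = refl
bit-injective {false} {false} _ = refl

[bit+qr]%q≡bit : (q : ℕ) (s : Bool) (r : ℕ) → (bit s + suc (suc q) * r) % suc (suc q) ≡ bit s
[bit+qr]%q≡bit q s r = begin
  (bit s + suc (suc q) * r) % suc (suc q) ≡⟨ cong (λ t → (bit s + t) % suc (suc q)) (*-comm (suc (suc q)) r) ⟩
  (bit s + r * suc (suc q)) % suc (suc q) ≡⟨ [m+kn]%n≡m%n (bit s) r (suc (suc q)) ⟩
  bit s % suc (suc q)                     ≡⟨ m<n⇒m%n≡m (bit<2+q s) ⟩
  bit s                                   ∎
  where
    open ≡-Reasoning
    bit<2+q : ∀ s → bit s < suc (suc q)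
    bit<2+q true  = s≤s (s≤s z≤n)
    bit<2+q false = s≤s z≤n

bit+q*-injective : (q : ℕ) {s t : Bool} {r r′ : ℕ} →
  bit s + suc (suc q) * r ≡ bit t + suc (suc q) * r′ → s ≡ t × r ≡ r′
bit+q*-injective q {s} {t} {r} {r′} e
  with refl ← bit-injective (trans (sym ([bit+qr]%q≡bit q s r)) (trans (cong (_% suc (suc q)) e) ([bit+qr]%q≡bit q t r′))) =
  refl , *-cancelˡ-≡ r r′ (suc (suc q)) (+-cancelˡ-≡ (bit s) _ _ e)

rtSum≡0⇒∅ : (q : ℕ) (D : Subset n) → rtSum (suc (suc q)) D ≡ 0 → ¬ d ∈ℕ D
rtSum≡0⇒∅ q (s ∷ D) e d∈sD
  with refl , e′ ← bit+q*-injective q {s} {false} {rtSum _ D} {0}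
                      (trans (sym (rtSum-∷ _ s D)) (trans e (sym (*-zeroʳ (suc (suc q))))))
  with d∈sD
... | suc i , refl , there i∈D = rtSum≡0⇒∅ q D e′ (i , refl , i∈D)

rtSum-injective : (q : ℕ) (D : Subset n) (D₁ : Subset m) →
                  rtSum (suc (suc q)) D ≡ rtSum (suc (suc q)) D₁ → SameSet D D₁
rtSum-injective q []      D₁       e = SameSet-∅ (λ ()) (rtSum≡0⇒∅ q D₁ (sym e))
rtSum-injective q D       []       e = SameSet-∅ (rtSum≡0⇒∅ q D e) (λ ())
rtSum-injective q (s ∷ D) (t ∷ D₁) e
  with refl , e′ ← bit+q*-injective q {s} {t} (trans (sym (rtSum-∷ _ s D)) (trans e (rtSum-∷ _ t D₁))) =
  SameSet-∷ (rtSum-injective q D D₁ e′)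

Degree-unique : ∀ {x} → Degree G x d → Degree G x d′ → d ≡ d′
Degree-unique (us , us! , us-nbr , refl) (vs , vs! , vs-nbr , refl) =
  ↭-length (∼bag⇒↭ (unique∧set⇒bag us! vs! λ {w} → ⇔-trans (us-nbr w) (⇔-sym (vs-nbr w))))

CompIso-Degree : ∀ {x y} (iso : CompIso G H x y) → Degree G x d → Degree H (proj₁ iso x) d
CompIso-Degree {G = G} {H} {x = x} {y} (f , g , f-reach , g-reach , g∘f , f∘g , f-adj)
               (us , us! , us-nbr , refl) =
  List.map f us , fus! , fus-nbr , List.length-map f us
  where
    us-reach : ∀ {u} → u ∈ us → Reach G x u
    us-reach u∈us = to (us-nbr _) u∈us ◅ ε
    fus! : Unique (List.map f us)
    fus! = Unique.map⁻ {f = g} (subst Unique (sym gfus≡us) us!)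
      where
        gfus≡us : List.map g (List.map f us) ≡ us
        gfus≡us = trans (sym (List.map-∘ us))
                        (List.map-id-local (All.tabulate (λ u∈us → g∘f _ (us-reach u∈us))))
    fus-nbr : ∀ w → w ∈ List.map f us ⇔ Adj H (f x) w
    fus-nbr w = mk⇔ forth back
      where
        forth : w ∈ List.map f us → Adj H (f x) w
        forth w∈ with u , u∈us , refl ← ∈-map⁻ f w∈ =
          to (f-adj x u ε (us-reach u∈us)) (to (us-nbr u) u∈us)
        back : Adj H (f x) w → w ∈ List.map f us
        back fx~w = subst (_∈ List.map f us) fgw≡w (∈-map⁺ f (from (us-nbr (g w)) x~gw))
          where
            w-reach : Reach H y w
            w-reach = f-reach x ε ◅◅ (fx~w ◅ ε)
            fgw≡w : f (g w) ≡ w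
            fgw≡w = f∘g w w-reach
            x~gw : Adj G x (g w)
            x~gw = from (f-adj x (g w) ε (g-reach w w-reach)) (subst (Adj H (f x)) (sym fgw≡w) fx~w)

Clique : Graph → ℕ → Set
Clique G c = Σ (Fin c → V G) (λ h → ∀ i j → i ≢ j → Adj G (h i) (h j))

clique≤colours : Clique G c → Colorable G c′ → c ≤ c′
clique≤colours (h , h-adj) (col , col-proper) = Fin.injective⇒≤ λ {i} {j} e →
  decidable-stable (i Fin.≟ j) (λ i≢j → col-proper _ _ (h-adj i j i≢j) e)

clique⇒ChromaticNumber : Colorable G c → Clique G c → ChromaticNumber G c
clique⇒ChromaticNumber col clique = col , λ _ col′ → clique≤colours clique col′

ChromaticNumber-unique : ChromaticNumber G c → ChromaticNumber G c′ → c ≡ c′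
ChromaticNumber-unique (col , c-min) (col′ , c′-min) = ≤-antisym (c-min _ col′) (c′-min _ col)

-- Degrees

length-cartesianProductWith : (f : A → B → C) (xs : List A) (ys : List B) →
  length (cartesianProductWith f xs ys) ≡ length xs * length ys
length-cartesianProductWith f []       ys = refl
length-cartesianProductWith f (x List.∷ xs) ys = begin
  length (List.map (f x) ys ++ cartesianProductWith f xs ys)          ≡⟨ List.length-++ (List.map (f x) ys) ⟩
  length (List.map (f x) ys) + length (cartesianProductWith f xs ys) ≡⟨ cong₂ _+_ (List.length-map (f x) ys)
                                                                          (length-cartesianProductWith f xs ys) ⟩
  length ys + length xs * length ys                                   ∎
  where open ≡-Reasoning

∈-cartesianProductWith-∷ : {a : A} {y : Vec A n} {as : List A} {ys : List (Vec A n)} →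
  a ∷ y ∈ cartesianProductWith _∷_ as ys ⇔ (a ∈ as × y ∈ ys)
∈-cartesianProductWith-∷ {a = a} {y} {as} {ys} =
  mk⇔ forth (λ (a∈ , y∈) → ∈-cartesianProductWith⁺ _∷_ a∈ y∈)
  where
    forth : a ∷ y ∈ cartesianProductWith _∷_ as ys → a ∈ as × y ∈ ys
    forth a∷y∈ with _ , _ , a∈ , y∈ , refl ← ∈-cartesianProductWith⁻ _∷_ as ys a∷y∈ = a∈ , y∈

Adj⇔ρ∈ℕ : {D : Subset n} (x y : Vec (Fin (suc k)) n) → Adj (DistGraph (suc k) n D) x y ⇔ ρ x y ∈ℕ D
Adj⇔ρ∈ℕ {D = D} x y = mk⇔ proj₂ λ p → (λ { refl → 0∉ℕ D (subst (_∈ℕ D) (ρ-self x) p) }) , p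

others : Fin (suc k) → List (Fin (suc k))
others {k} a = List.map (Fin.punchIn a) (allFin k)

∈-others : {a b : Fin (suc k)} → b ∈ others a ⇔ a ≢ b
∈-others {a = a} = mk⇔
  (λ b∈ → let j , _ , b≡ = ∈-map⁻ (Fin.punchIn a) b∈ in λ a≡b → Fin.punchInᵢ≢i a j (sym (trans a≡b b≡)))
  (λ a≢b → subst (_∈ others a) (Fin.punchIn-punchOut a≢b) (∈-map⁺ (Fin.punchIn a) (∈-allFin _)))

others! : (a : Fin (suc k)) → Unique (others a)
others! {k} a = Unique.map⁺ (Fin.punchIn-injective a _ _) (Unique.allFin⁺ k)

length-others : (a : Fin (suc k)) → length (others a) ≡ k
length-others {k} a = trans (List.length-map (Fin.punchIn a) (allFin k)) (List.length-tabulate id)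

headChanges : Bool → Fin (suc k) → Vec (Fin (suc k)) n → List (Vec (Fin (suc k)) (suc n))
headChanges true  a x = List.map (_∷ x) (others a)
headChanges false a x = []

∈-headChanges : {a b : Fin (suc k)} {x y : Vec (Fin (suc k)) n} →
  b ∷ y ∈ headChanges s a x ⇔ (a ≢ b × x ≡ y × s ≡ true)
∈-headChanges {s = true} {a} {b} {x} {y} =
  mk⇔ forth λ { (a≢b , refl , _) → ∈-map⁺ (_∷ x) (from ∈-others a≢b) }
  where
    forth : b ∷ y ∈ headChanges true a x → a ≢ b × x ≡ y × true ≡ true
    forth b∷y∈ with _ , b∈ , refl ← ∈-map⁻ (_∷ x) b∷y∈ = to ∈-others b∈ , refl , refl
∈-headChanges {s = false} = mk⇔ (λ ()) λ { (_ , _ , ()) }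

neighbours : Subset n → Vec (Fin (suc k)) n → List (Vec (Fin (suc k)) n)
neighbours []      []      = []
neighbours (s ∷ D) (a ∷ x) = headChanges s a x ++ cartesianProductWith _∷_ (allFin _) (neighbours D x)

∈-neighbours : (D : Subset n) (x y : Vec (Fin (suc k)) n) → y ∈ neighbours D x ⇔ ρ x y ∈ℕ D
∈-neighbours []      []      []      = mk⇔ (λ ()) λ { (() , _) }
∈-neighbours (s ∷ D) (a ∷ x) (b ∷ y) =
  ⇔-trans ++-∈⇔ (⇔-trans (∈-headChanges ⊎-⇔ ∈-prefixed) (⇔-sym (ρ-∷-∈ℕ a b x y)))
  where
    ∈-prefixed : b ∷ y ∈ cartesianProductWith _∷_ (allFin _) (neighbours D x) ⇔ ρ x y ∈ℕ D
    ∈-prefixed = ⇔-trans ∈-cartesianProductWith-∷ (⇔-trans (mk⇔ proj₂ (∈-allFin b ,_)) (∈-neighbours D x y))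

neighbours! : (D : Subset n) (x : Vec (Fin (suc k)) n) → Unique (neighbours D x)
neighbours! []      []      = []
neighbours! (s ∷ D) (a ∷ x) =
  Unique.++⁺ (headChanges! s)
             (Unique.cartesianProductWith⁺ _∷_ ∷-injective (Unique.allFin⁺ _) (neighbours! D x))
             disjoint
  where
    headChanges! : ∀ s → Unique (headChanges s a x)
    headChanges! true  = Unique.map⁺ ∷-injectiveˡ (others! a)
    headChanges! false = []
    disjoint : Disjoint (headChanges s a x) (cartesianProductWith _∷_ (allFin _) (neighbours D x))
    disjoint {b ∷ y} (∈heads , ∈prefixed) with _ , refl , _ ← to (∈-headChanges {s = s} {a = a} {x = x}) ∈heads =
      0∉ℕ D (subst (_∈ℕ D) (ρ-self x) (to (∈-neighbours D x x) y∈neighbours))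
      where
        y∈neighbours : x ∈ neighbours D x
        y∈neighbours = proj₂ (to (∈-cartesianProductWith-∷ {as = allFin _}) ∈prefixed)

length-neighbours : (D : Subset n) (x : Vec (Fin (suc k)) n) → length (neighbours D x) ≡ k * rtSum (suc k) D
length-neighbours {k = k} []      []      = sym (*-zeroʳ k)
length-neighbours {k = k} (s ∷ D) (a ∷ x) = begin
  length (headChanges s a x ++ prefixed)                ≡⟨ List.length-++ (headChanges s a x) ⟩
  length (headChanges s a x) + length prefixed          ≡⟨ cong₂ _+_ (length-headChanges s) length-prefixed ⟩
  k * bit s + suc k * (k * rtSum (suc k) D)             ≡⟨ cong (k * bit s +_) (x∙yz≈y∙xz (suc k) k _) ⟩
  k * bit s + k * (suc k * rtSum (suc k) D)             ≡⟨ *-distribˡ-+ k (bit s) _ ⟨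
  k * (bit s + suc k * rtSum (suc k) D)                 ≡⟨ cong (k *_) (rtSum-∷ (suc k) s D) ⟨
  k * rtSum (suc k) (s ∷ D)                             ∎
  where
    open ≡-Reasoning
    prefixed : List (Vec (Fin (suc k)) (suc _))
    prefixed = cartesianProductWith _∷_ (allFin (suc k)) (neighbours D x)
    length-headChanges : ∀ s → length (headChanges s a x) ≡ k * bit s
    length-headChanges true  =
      trans (List.length-map (_∷ x) (others a)) (trans (length-others a) (sym (*-identityʳ k)))
    length-headChanges false = sym (*-zeroʳ k)
    length-prefixed : length prefixed ≡ suc k * (k * rtSum (suc k) D)
    length-prefixed = trans (length-cartesianProductWith _∷_ (allFin (suc k)) (neighbours D x))
                            (cong₂ _*_ (List.length-tabulate {n = suc k} id) (length-neighbours D x))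

DistGraph-regular : (D : Subset n) → Regular (DistGraph (suc k) n D) (k * rtSum (suc k) D)
DistGraph-regular D x =
  neighbours D x , neighbours! D x ,
  (λ y → ⇔-trans (∈-neighbours D x y) (⇔-sym (Adj⇔ρ∈ℕ x y))) , length-neighbours D x

-- Components

Reach⇒ρ≤ : {D : Subset n} → (∀ {d} → d ∈ℕ D → d ≤ K) →
           {x u : Vec (Fin (suc k)) n} → Reach (DistGraph (suc k) n D) x u → ρ x u ≤ K
Reach⇒ρ≤ bound {x} ε = ρ-self-≤ x
Reach⇒ρ≤ bound {x} {u} (_◅_ {j = y} (_ , ρxy∈D) y⇝u) =
  ρ-ultrametric _ x y u (bound ρxy∈D) (Reach⇒ρ≤ bound y⇝u)

midpoint : (K : ℕ) (x u : Vec (Fin (suc (suc k))) n) → K ≤ n → ρ x u < K → ∃[ z ] ρ x z ≡ K × ρ z u ≡ K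
midpoint (suc zero) (a ∷ x) u _ ρ<1 with refl ← ρ≡0⇒≡ (a ∷ x) u (n<1⇒n≡0 ρ<1) =
  Fin.punchIn a zero ∷ x , ρ-∷-head x (b≢a ∘ sym) , ρ-∷-head x b≢a
  where
    b≢a : Fin.punchIn a zero ≢ a
    b≢a = Fin.punchInᵢ≢i a zero
midpoint (suc (suc K)) (a ∷ x) (b ∷ u) (s≤s K<n) ρ<K
  with z , ρxz≡K , ρzu≡K ← midpoint (suc K) x u K<n (s≤s (to (ρ-∷-≤ a b x u) (s≤s⁻¹ ρ<K))) =
  a ∷ z , ρ-∷-tail a a x z ρxz≡K , ρ-∷-tail a b z u ρzu≡K

ρ≤⇒Reach : {D : Subset n} → K ∈ℕ D →
           (x u : Vec (Fin (suc (suc k))) n) → ρ x u ≤ K → Reach (DistGraph (suc (suc k)) n D) x u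
ρ≤⇒Reach {K = K} {D = D} K∈D x u ρ≤K with m≤n⇒m<n∨m≡n ρ≤K
... | inj₂ ρ≡K = from (Adj⇔ρ∈ℕ x u) (subst (_∈ℕ D) (sym ρ≡K) K∈D) ◅ ε
... | inj₁ ρ<K with z , ρxz≡K , ρzu≡K ← midpoint K x u (∈ℕ⇒≤ K∈D) ρ<K =
  from (Adj⇔ρ∈ℕ x z) (subst (_∈ℕ D) (sym ρxz≡K) K∈D) ◅
  from (Adj⇔ρ∈ℕ z u) (subst (_∈ℕ D) (sym ρzu≡K) K∈D) ◅ ε

Reach⇔ρ≤ : {D : Subset n} → IsMaximum D K → (x u : Vec (Fin (suc (suc k))) n) →
           Reach (DistGraph (suc (suc k)) n D) x u ⇔ ρ x u ≤ K
Reach⇔ρ≤ (K∈D , K-max) x u = mk⇔ (Reach⇒ρ≤ K-max) (ρ≤⇒Reach K∈D x u)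

Connected⇔n∈ℕ : 1 ≤ n → (D : Subset n) → Nonempty D → Connected (DistGraph (suc (suc k)) n D) ⇔ n ∈ℕ D
Connected⇔n∈ℕ {n} {k} 1≤n D D≠∅ = mk⇔ forth λ n∈D x u → ρ≤⇒Reach n∈D x u (ρ≤n x u)
  where
    0ⁿ : Vec (Fin (suc (suc k))) n
    0ⁿ = replicate n zero
    forth : Connected (DistGraph (suc (suc k)) n D) → n ∈ℕ D
    forth connected
      with K , K∈D , K-max ← maximum D D≠∅
         | z , ρ≡n , _ ← midpoint n 0ⁿ 0ⁿ ≤-refl (subst (_< n) (sym (ρ-self 0ⁿ)) 1≤n)
      = subst (_∈ℕ D) (≤-antisym (∈ℕ⇒≤ K∈D) (subst (_≤ K) ρ≡n (Reach⇒ρ≤ K-max (connected 0ⁿ z)))) K∈D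

-- With K = max D, this maps the component of x (the ball of radius K around x) onto that of y.
graft : ℕ → Vec A n → Vec A m → Vec A m
graft zero    u       y       = y
graft (suc K) u       []      = []
graft (suc K) []      (b ∷ y) = b ∷ y
graft (suc K) (a ∷ u) (b ∷ y) = a ∷ graft K u y

ρ-graft-≤ : (K : ℕ) (u : Vec (Fin (suc k)) n) (y : Vec (Fin (suc k)) m) → ρ y (graft K u y) ≤ K
ρ-graft-≤ zero    u       y       = ρ-self-≤ y
ρ-graft-≤ (suc K) u       []      = z≤n
ρ-graft-≤ (suc K) []      (b ∷ y) = ρ-self-≤ (b ∷ y)
ρ-graft-≤ (suc K) (a ∷ u) (b ∷ y) = from (ρ-∷-≤ b a y (graft K u y)) (ρ-graft-≤ K u y)

graft-id : (K : ℕ) (x u : Vec (Fin (suc k)) n) → ρ x u ≤ K → graft K u x ≡ u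
graft-id zero    x       u       ρ≤0 = ρ≡0⇒≡ x u (n≤0⇒n≡0 ρ≤0)
graft-id (suc K) []      []      _   = refl
graft-id (suc K) (b ∷ x) (a ∷ u) ρ≤K = cong (a ∷_) (graft-id K x u (to (ρ-∷-≤ b a x u) ρ≤K))

graft-graft : (K : ℕ) (u x : Vec A n) (y : Vec A m) → K ≤ m → graft K (graft K u y) x ≡ graft K u x
graft-graft zero    u       x       y       _         = refl
graft-graft (suc K) []      []      y       _         = refl
graft-graft (suc K) (a ∷ u) (b ∷ x) (c ∷ y) (s≤s K≤m) = cong (a ∷_) (graft-graft K u x y K≤m)

ρ-graft : (K : ℕ) (u v : Vec (Fin (suc k)) n) (y : Vec (Fin (suc k)) m) → K ≤ m → ρ u v ≤ K →
          ρ (graft K u y) (graft K v y) ≡ ρ u v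
ρ-graft zero    u       v       y       _         ρ≤0 with refl ← ρ≡0⇒≡ u v (n≤0⇒n≡0 ρ≤0) =
  trans (ρ-self y) (sym (ρ-self u))
ρ-graft (suc K) []      []      y       _         _   = ρ-self (graft (suc K) [] y)
ρ-graft (suc K) (a ∷ u) (b ∷ v) (c ∷ y) (s≤s K≤m) ρ≤K =
  ρ-∷-cong a b (graft K u y) (graft K v y) u v (ρ-graft K u v y K≤m (to (ρ-∷-≤ a b u v) ρ≤K))

SameSet⇒CompIso : {D : Subset n} {D₁ : Subset m} → SameSet D D₁ → IsMaximum D K →
  (x : Vec (Fin (suc (suc k))) n) (y : Vec (Fin (suc (suc k))) m) →
  CompIso (DistGraph (suc (suc k)) n D) (DistGraph (suc (suc k)) m D₁) x y
SameSet⇒CompIso {n} {m} {K} {k} {D} {D₁} same K-max x y =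
  f , g , (λ u _ → from (ball₁ y (f u)) (ρ-graft-≤ K u y)) , (λ w _ → from (ball x (g w)) (ρ-graft-≤ K w x)) ,
  (λ u x⇝u → trans (graft-graft K u x y K≤m) (graft-id K x u (to (ball x u) x⇝u))) ,
  (λ w y⇝w → trans (graft-graft K w y x K≤n) (graft-id K y w (to (ball₁ y w) y⇝w))) ,
  f-adj
  where
    Gⁿ Gᵐ : Graph
    Gⁿ = DistGraph (suc (suc k)) n D
    Gᵐ = DistGraph (suc (suc k)) m D₁
    K-max₁ : IsMaximum D₁ K
    K-max₁ = IsMaximum-SameSet same K-max
    ball : ∀ x u → Reach Gⁿ x u ⇔ ρ x u ≤ K
    ball = Reach⇔ρ≤ K-max
    ball₁ : ∀ y w → Reach Gᵐ y w ⇔ ρ y w ≤ K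
    ball₁ = Reach⇔ρ≤ K-max₁
    K≤n : K ≤ n
    K≤n = ∈ℕ⇒≤ (proj₁ K-max)
    K≤m : K ≤ m
    K≤m = ∈ℕ⇒≤ (proj₁ K-max₁)
    f : V Gⁿ → V Gᵐ
    f u = graft K u y
    g : V Gᵐ → V Gⁿ
    g w = graft K w x
    f-adj : ∀ u v → Reach Gⁿ x u → Reach Gⁿ x v → Adj Gⁿ u v ⇔ Adj Gᵐ (f u) (f v)
    f-adj u v x⇝u x⇝v = ⇔-trans (Adj⇔ρ∈ℕ u v) (⇔-trans (same (ρ u v))
      (⇔-sym (subst (λ t → Adj Gᵐ (f u) (f v) ⇔ t ∈ℕ D₁) ρfufv≡ρuv (Adj⇔ρ∈ℕ (f u) (f v)))))
      where
        ρuv≤K : ρ u v ≤ K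
        ρuv≤K = ρ-ultrametric K u x v (subst (_≤ K) (ρ-sym x u) (to (ball x u) x⇝u)) (to (ball x v) x⇝v)
        ρfufv≡ρuv : ρ (f u) (f v) ≡ ρ u v
        ρfufv≡ρuv = ρ-graft K u v y K≤m ρuv≤K

ComponentsIso⇒SameSet : (D : Subset n) (D₁ : Subset m) →
  ComponentsIso (DistGraph (suc (suc k)) n D) (DistGraph (suc (suc k)) m D₁) → SameSet D D₁
ComponentsIso⇒SameSet {n} {m} {k} D D₁ iso = rtSum-injective k D D₁ (*-cancelˡ-≡ _ _ (suc k) degrees-agree)
  where
    x : Vec (Fin (suc (suc k))) n
    x = replicate n zero
    x-iso : CompIso (DistGraph (suc (suc k)) n D) (DistGraph (suc (suc k)) m D₁) x (replicate m zero)
    x-iso = iso x (replicate m zero)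
    degrees-agree : suc k * rtSum (suc (suc k)) D ≡ suc k * rtSum (suc (suc k)) D₁
    degrees-agree = Degree-unique {G = DistGraph (suc (suc k)) m D₁}
      (CompIso-Degree x-iso (DistGraph-regular D x)) (DistGraph-regular D₁ (proj₁ x-iso x))

ComponentsIso⇔SameSet : (D : Subset n) (D₁ : Subset m) → Nonempty D →
  ComponentsIso (DistGraph (suc (suc k)) n D) (DistGraph (suc (suc k)) m D₁) ⇔ SameSet D D₁
ComponentsIso⇔SameSet D D₁ D≠∅ =
  mk⇔ (ComponentsIso⇒SameSet D D₁) (λ same → SameSet⇒CompIso same (proj₂ (maximum D D≠∅)))

-- Chromatic number

code : (D : Subset n) → Vec (Fin (suc k)) n → Fin (suc k ^ ∣ D ∣)
code []          []      = zero
code (true ∷ D)  (a ∷ x) = Fin.combine a (code D x)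
code (false ∷ D) (a ∷ x) = code D x

code-proper : (D : Subset n) (x y : Vec (Fin (suc k)) n) → ρ x y ∈ℕ D → code D x ≢ code D y
code-proper []      []      []      (() , _)
code-proper (s ∷ D) (a ∷ x) (b ∷ y) ρ∈sD with to (ρ-∷-∈ℕ a b x y) ρ∈sD
... | inj₁ (a≢b , refl , refl) = a≢b ∘ Fin.combine-injectiveˡ a (code D x) b (code D x)
... | inj₂ ρ∈D = on-tails s (code-proper D x y ρ∈D)
  where
    on-tails : ∀ s → code D x ≢ code D y → code (s ∷ D) (a ∷ x) ≢ code (s ∷ D) (b ∷ y)
    on-tails true  tails≢ = tails≢ ∘ Fin.combine-injectiveʳ a (code D x) b (code D y)
    on-tails false tails≢ = tails≢

decode : (D : Subset n) → Fin (suc k ^ ∣ D ∣) → Vec (Fin (suc k)) n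
decode []          _ = []
decode {k = k} (true ∷ D) i = proj₁ (Fin.remQuot {suc k} _ i) ∷ decode D (proj₂ (Fin.remQuot {suc k} _ i))
decode (false ∷ D) i = zero ∷ decode D i

decode-clique : (D : Subset n) {i j : Fin (suc k ^ ∣ D ∣)} → i ≢ j → ρ (decode D i) (decode D j) ∈ℕ D
decode-clique []          {zero} {zero} i≢j = ⊥-elim (i≢j refl)
decode-clique (false ∷ D) {i} {j} i≢j =
  from (ρ-∷-∈ℕ zero zero (decode D i) (decode D j)) (inj₂ (decode-clique D i≢j))
decode-clique {k = k} (true ∷ D) {i} {j} i≢j =
  on-pairs (Fin.remQuot {suc k} _ i) (Fin.remQuot {suc k} _ j) (i≢j ∘ remQuot-injective)
  where
    remQuot-injective : Fin.remQuot {suc k} (suc k ^ ∣ D ∣) i ≡ Fin.remQuot (suc k ^ ∣ D ∣) j → i ≡ j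
    remQuot-injective e = trans (sym (Fin.combine-remQuot {suc k} (suc k ^ ∣ D ∣) i))
                                (trans (cong (uncurry Fin.combine) e) (Fin.combine-remQuot {suc k} (suc k ^ ∣ D ∣) j))
    on-pairs : ∀ p p′ → p ≢ p′ →
               ρ (proj₁ p ∷ decode D (proj₂ p)) (proj₁ p′ ∷ decode D (proj₂ p′)) ∈ℕ (true ∷ D)
    on-pairs (a , i′) (b , j′) p≢p′ with i′ Fin.≟ j′
    ... | yes refl =
      from (ρ-∷-∈ℕ a b (decode D i′) (decode D i′)) (inj₁ ((λ { refl → p≢p′ refl }) , refl , refl))
    ... | no i′≢j′ = from (ρ-∷-∈ℕ a b (decode D i′) (decode D j′)) (inj₂ (decode-clique D i′≢j′))

DistGraph-χ : (D : Subset n) → ChromaticNumber (DistGraph (suc k) n D) (suc k ^ ∣ D ∣)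
DistGraph-χ D = clique⇒ChromaticNumber
  (code D , λ x y x~y → code-proper D x y (to (Adj⇔ρ∈ℕ x y) x~y))
  (decode D , λ i j i≢j → from (Adj⇔ρ∈ℕ (decode D i) (decode D j)) (decode-clique D i≢j))

^-injectiveʳ : (q : ℕ) → 1 < q → {a b : ℕ} → q ^ a ≡ q ^ b → a ≡ b
^-injectiveʳ q 1<q {a} {b} e with <-cmp a b
... | tri< a<b _ _ = contradiction e (<⇒≢ (^-monoʳ-< q 1<q a<b))
... | tri≈ _ a≡b _ = a≡b
... | tri> _ _ b<a = contradiction e (>⇒≢ (^-monoʳ-< q 1<q b<a))

χ≡χ⇔∣∣≡∣∣ : (D₁ D₂ : Subset n) {c₁ c₂ : ℕ} →
  ChromaticNumber (DistGraph (suc (suc k)) n D₁) c₁ → ChromaticNumber (DistGraph (suc (suc k)) n D₂) c₂ →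
  c₁ ≡ c₂ ⇔ ∣ D₁ ∣ ≡ ∣ D₂ ∣
χ≡χ⇔∣∣≡∣∣ {k = k} D₁ D₂ {c₁} {c₂} χ₁ χ₂ = mk⇔
  (λ c₁≡c₂ → ^-injectiveʳ (suc (suc k)) (s≤s (s≤s z≤n)) (trans (sym c₁≡) (trans c₁≡c₂ c₂≡)))
  (λ ∣D₁∣≡∣D₂∣ → trans c₁≡ (trans (cong (suc (suc k) ^_) ∣D₁∣≡∣D₂∣) (sym c₂≡)))
  where
    c₁≡ : c₁ ≡ suc (suc k) ^ ∣ D₁ ∣
    c₁≡ = ChromaticNumber-unique χ₁ (DistGraph-χ D₁)
    c₂≡ : c₂ ≡ suc (suc k) ^ ∣ D₂ ∣
    c₂≡ = ChromaticNumber-unique χ₂ (DistGraph-χ D₂)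

corollary3p1 : (q n : ℕ) → 2 ≤ q → 1 ≤ n → (D : Subset n) → Nonempty D →
      Regular (DistGraph q n D) ((q ∸ 1) * rtSum q D)
    × (Connected (DistGraph q n D) ⇔ (n ∈ℕ D))
    × (∀ (m : ℕ) (D₁ : Subset m) → 1 ≤ m → Nonempty D₁ →
         ComponentsIso (DistGraph q n D) (DistGraph q m D₁) ⇔ SameSet D D₁)
    × ChromaticNumber (DistGraph q n D) (q ^ ∣ D ∣)
    × (∀ (D₁ D₂ : Subset n) → Nonempty D₁ → Nonempty D₂ → ∀ (c₁ c₂ : ℕ) →
         ChromaticNumber (DistGraph q n D₁) c₁ → ChromaticNumber (DistGraph q n D₂) c₂ →
         (c₁ ≡ c₂) ⇔ (∣ D₁ ∣ ≡ ∣ D₂ ∣))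
corollary3p1 (suc (suc k)) n _ 1≤n D D≠∅ =
    DistGraph-regular D
  , Connected⇔n∈ℕ 1≤n D D≠∅
  , (λ m D₁ _ _ → ComponentsIso⇔SameSet D D₁ D≠∅)
  , DistGraph-χ D
  , λ D₁ D₂ _ _ _ _ → χ≡χ⇔∣∣≡∣∣ D₁ D₂
corollary3p1 (suc zero) _ (s≤s ()) _ _ _
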